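{- Let $n\geq 3$ and $0\leq r\leq n-2$ be integers, let $G_n\in HL_n$, and let $S\subseteq E(G_n)$ be an edge subset with $|S|\leq 2^r(n-r)-1$. Then $G_n-S$ has a connected component $C$ with $|V(C)|\geq 2^n-(2^r-1)$.
   Context: Hypercube-like networks (HL-networks) are defined recursively: $HL_0=\{K_1\}$ (a single vertex), and for $n\geq 1$, $HL_n$ is the set of all graphs obtained from the disjoint union of two graphs $G_{n-1},G'_{n-1}\in HL_{n-1}$ by adding the edges of an arbitrary perfect matching between $V(G_{n-1})$ and $V(G'_{n-1})$. Every $G_n\in HL_n$ is $n$-regular with $2^n$ vertices. $G_n-S$ denotes the graph obtained from $G_n$ by deleting the edges in $S$ (keeping all vertices). -}

module Defs where

open import Data.Nat using (ℕ; zero; suc; _+_; _<ᵇ_)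
open import Data.Bool using (Bool; true; false; _∧_; not; if_then_else_)
open import Data.Fin using (Fin; toℕ; splitAt)
open import Data.Fin.Properties using (_≟_)
open import Data.Sum using (inj₁; inj₂)
open import Data.List using (List; map; allFin)
open import Data.Nat.ListAction using (sum)
open import Relation.Nullary.Decidable using (⌊_⌋)
open import Relation.Binary.PropositionalEquality using (_≡_)

-- A (Boolean-valued) graph on the vertex set Fin k, given by its adjacency
-- relation.  HL-graphs below are always simple (symmetric, loopless).
Graph : ℕ → Set
Graph k = Fin k → Fin k → Bool

K₁ : Graph 1
K₁ _ _ = false

-- A perfect matching between two copies of Fin m, i.e. a bijection σ.
record PerfectMatching (m : ℕ) : Set where
  field
    σ   : Fin m → Fin m
    σ⁻¹ : Fin m → Fin m
    left  : ∀ x → σ⁻¹ (σ x) ≡ x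
    right : ∀ y → σ (σ⁻¹ y) ≡ y

-- Disjoint union of G (vertices 0..m-1) and G' (vertices m..2m-1) plus the
-- matching edges {u, σ u}.
join : {m : ℕ} → Graph m → Graph m → PerfectMatching m → Graph (m + m)
join {m} G G' M x y with splitAt m x | splitAt m y
... | inj₁ u | inj₁ v = G u v
... | inj₂ u | inj₂ v = G' u v
... | inj₁ u | inj₂ v = ⌊ PerfectMatching.σ M u ≟ v ⌋
... | inj₂ u | inj₁ v = ⌊ PerfectMatching.σ M v ≟ u ⌋

data HL : (n : ℕ) (k : ℕ) → Graph k → Set where
  hl₀ : HL zero 1 K₁
  hl₊ : ∀ {n m} {G G' : Graph m} → HL n m G → HL n m G' →
        (M : PerfectMatching m) → HL (suc n) (m + m) (join G G' M)

record EdgeSubset {k : ℕ} (G : Graph k) : Set where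
  field
    mem  : Fin k → Fin k → Bool
    sym  : ∀ u v → mem u v ≡ mem v u
    sub  : ∀ u v → mem u v ≡ true → G u v ≡ true

size : {k : ℕ} {G : Graph k} → EdgeSubset G → ℕ
size {k} S =
  sum (map (λ u → sum (map (λ v →
    if (toℕ u <ᵇ toℕ v) ∧ EdgeSubset.mem S u v then 1 else 0) (allFin k))) (allFin k))

_─_ : {k : ℕ} (G : Graph k) → EdgeSubset G → Graph k
(G ─ S) u v = G u v ∧ not (EdgeSubset.mem S u v)

data Reach {k : ℕ} (G : Graph k) : Fin k → Fin k → Set where
  here : ∀ {u} → Reach G u u
  step : ∀ {u w v} → G u w ≡ true → Reach G w v → Reach G u v

{-# OPTIONS --safe #-}
-- Let h(k) = h(⌊k/2⌋) + h(⌈k/2⌉) + ⌊k/2⌋ be the maximal number of edges spanned by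
-- k vertices of a hypercube (cubeEdges below).  Induction along the construction of
-- HL_n shows that every vertex set X of an HL_n-graph has at least n|X| − 2h(|X|)
-- boundary edges: if X meets the two halves in a and b vertices, the perfect matching
-- contributes at least |a − b| of them, and h(a) + h(b) + min(a, b) ≤ h(a + b).  For
-- 2^r ≤ |X| ≤ 2^n − 2^r this is at least 2^r (n − r) > |S|.  A union of components of
-- G − S has all its boundary edges in S, so its size is never in that range.  Hence
-- a component with at least 2^r vertices has more than 2^n − 2^r of them; and if all
-- components had fewer than 2^r vertices, adding them one at a time would produce a
-- union of size in [2^r, 2^(r+1)), which lies in the range since 2^(r+2) ≤ 2^n.
module Submission where

open import Defs
open import Data.Nat using (ℕ; _+_; _*_; _∸_; _^_; _≤_)
open import Data.Fin using (Fin)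
open import Data.List using (List; length)
open import Data.List.Relation.Unary.All using (All)
open import Data.List.Relation.Unary.Unique.Propositional using (Unique)
open import Data.Product using (Σ; _×_)

open import Data.Nat.Properties hiding (_≟_)
open import Algebra.Properties.CommutativeMonoid.Sum +-0-commutativeMonoid
  using (sum; sum-syntax; ∑-distrib-+; ∑-comm; sum-cong-≗; ∑-permute; sum-replicate-zero)
open import Data.Bool using (Bool; true; false; _∧_; _∨_; not; if_then_else_)
import Data.Bool.Properties as Bool
open import Data.Empty using (⊥; ⊥-elim)
open import Data.Fin using (zero; suc; toℕ; _↑ˡ_; _↑ʳ_; splitAt)
open import Data.Fin.Permutation using (Permutation′; permutation)
open import Data.Fin.Properties using (_≟_; any?; toℕ-injective; splitAt-↑ˡ; splitAt-↑ʳ)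
open import Data.List using ([]; _∷_; map; filter; allFin; tabulate)
import Data.List.Properties as List
open import Data.List.Membership.Propositional using (_∈_)
open import Data.List.Membership.Propositional.Properties using (∈-allFin)
open import Data.List.Relation.Unary.All as All using ()
open import Data.List.Relation.Unary.All.Properties using (all-filter)
open import Data.List.Relation.Unary.Any using (here; there)
open import Data.List.Relation.Unary.Unique.Propositional.Properties using (filter⁺; allFin⁺)
open import Data.Nat using (zero; suc; _<_; _<ᵇ_; _⊓_; z≤n; s≤s; z<s; _≤?_; ⌊_/2⌋; ⌈_/2⌉)
open import Data.Nat.Induction using (<-rec; <-wellFounded)
import Data.Nat.ListAction as List
open import Data.Nat.Tactic.RingSolver using (solve)
open import Data.Product using (_,_; proj₁; proj₂)
open import Data.Sum using (inj₁; inj₂)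
open import Induction.WellFounded using (WfRec; module FixPoint)
open import Relation.Binary.PropositionalEquality
open import Relation.Nullary using (yes; no; contradiction)
open import Relation.Nullary.Decidable using (⌊_⌋; dec-true; isYes≗does)

-- The edge function of hypercubes

private
  cubeEdges-step : ∀ k → WfRec _<_ (λ _ → ℕ) k → ℕ
  cubeEdges-step 0 _ = 0
  cubeEdges-step 1 _ = 0
  cubeEdges-step k@(suc (suc n)) rec = rec (⌊n/2⌋<n (suc n)) + rec (⌈n/2⌉<n n) + ⌊ k /2⌋

  cubeEdges-step-ext : ∀ k {IH IH′ : WfRec _<_ (λ _ → ℕ) k} →
                       (∀ {j} (j<k : j < k) → IH j<k ≡ IH′ j<k) →
                       cubeEdges-step k IH ≡ cubeEdges-step k IH′
  cubeEdges-step-ext 0 _ = refl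
  cubeEdges-step-ext 1 _ = refl
  cubeEdges-step-ext (suc (suc n)) eq = cong₂ (λ x y → x + y + _) (eq _) (eq _)

opaque
  cubeEdges : ℕ → ℕ
  cubeEdges = <-rec _ cubeEdges-step

  cubeEdges-split : ∀ k → cubeEdges k ≡ cubeEdges ⌊ k /2⌋ + cubeEdges ⌈ k /2⌉ + ⌊ k /2⌋
  cubeEdges-split 0 = refl
  cubeEdges-split 1 = refl
  cubeEdges-split (suc (suc n)) = FixPoint.unfold-wfRec <-wellFounded _ cubeEdges-step cubeEdges-step-ext

  cubeEdges-0 : cubeEdges 0 ≡ 0
  cubeEdges-0 = refl

  cubeEdges-1 : cubeEdges 1 ≡ 0
  cubeEdges-1 = refl

data ParityView : ℕ → Set where
  even : ∀ p → ParityView (2 * p)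
  odd  : ∀ p → ParityView (1 + 2 * p)

parityView : ∀ n → ParityView n
parityView 0 = even 0
parityView 1 = odd 0
parityView (suc (suc n)) with parityView n
... | even p = subst ParityView (*-suc 2 p) (even (suc p))
... | odd p  = subst ParityView (cong suc (*-suc 2 p)) (odd (suc p))

⌊2*n/2⌋≡n : ∀ n → ⌊ 2 * n /2⌋ ≡ n
⌊2*n/2⌋≡n n = sym (trans (n≡⌊n+n/2⌋ n) (cong ⌊_/2⌋ (cong (n +_) (sym (+-identityʳ n)))))

⌈2*n/2⌉≡n : ∀ n → ⌈ 2 * n /2⌉ ≡ n
⌈2*n/2⌉≡n n = sym (trans (n≡⌈n+n/2⌉ n) (cong ⌈_/2⌉ (cong (n +_) (sym (+-identityʳ n)))))

cubeEdges-double : ∀ p → cubeEdges (2 * p) ≡ 2 * cubeEdges p + p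
cubeEdges-double p = begin
  cubeEdges (2 * p)
    ≡⟨ cubeEdges-split (2 * p) ⟩
  cubeEdges ⌊ 2 * p /2⌋ + cubeEdges ⌈ 2 * p /2⌉ + ⌊ 2 * p /2⌋
    ≡⟨ cong₂ (λ x y → cubeEdges x + cubeEdges y + x) (⌊2*n/2⌋≡n p) (⌈2*n/2⌉≡n p) ⟩
  cubeEdges p + cubeEdges p + p
    ≡⟨ cong (λ x → cubeEdges p + x + p) (sym (+-identityʳ (cubeEdges p))) ⟩
  2 * cubeEdges p + p ∎
  where open ≡-Reasoning

cubeEdges-double+1 : ∀ p → cubeEdges (1 + 2 * p) ≡ cubeEdges p + cubeEdges (1 + p) + p
cubeEdges-double+1 p = begin
  cubeEdges (1 + 2 * p)
    ≡⟨ cubeEdges-split (1 + 2 * p) ⟩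
  cubeEdges ⌈ 2 * p /2⌉ + cubeEdges (1 + ⌊ 2 * p /2⌋) + ⌈ 2 * p /2⌉
    ≡⟨ cong₂ (λ x y → cubeEdges x + cubeEdges (1 + y) + x) (⌈2*n/2⌉≡n p) (⌊2*n/2⌋≡n p) ⟩
  cubeEdges p + cubeEdges (1 + p) + p ∎
  where open ≡-Reasoning

private
  double-step : ∀ n p E x → E + 2 * x ≤ n * p → 2 * E + 2 * (2 * x + p) ≤ suc n * (2 * p)
  double-step n p E x le = begin
    2 * E + 2 * (2 * x + p)  ≡⟨ solve (p ∷ E ∷ x ∷ []) ⟩
    2 * (E + 2 * x) + 2 * p  ≤⟨ +-monoˡ-≤ (2 * p) (*-monoʳ-≤ 2 le) ⟩
    2 * (n * p) + 2 * p      ≡⟨ solve (n ∷ p ∷ []) ⟩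
    suc n * (2 * p)          ∎
    where open ≤-Reasoning

  double+1-step : ∀ n p E E′ x y → E + 2 * x ≤ n * p → E′ + 2 * y ≤ n * (1 + p) →
                  E + E′ + 1 + 2 * (x + y + p) ≤ suc n * (1 + 2 * p)
  double+1-step n p E E′ x y le le′ = begin
    E + E′ + 1 + 2 * (x + y + p)             ≡⟨ solve (p ∷ E ∷ E′ ∷ x ∷ y ∷ []) ⟩
    (E + 2 * x) + (E′ + 2 * y) + (1 + 2 * p)  ≤⟨ +-monoˡ-≤ (1 + 2 * p) (+-mono-≤ le le′) ⟩
    n * p + n * (1 + p) + (1 + 2 * p)         ≡⟨ solve (n ∷ p ∷ []) ⟩
    suc n * (1 + 2 * p)                       ∎
    where open ≤-Reasoning

-- With F(n,k) = n k − 2 cubeEdges k, the next two lemmas say F(n+1,2p) = 2 F(n,p) and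
-- F(n+1,2p+1) = F(n,p) + F(n,p+1) + 1, in a form free of subtraction.
cubeEdges-double-bound : ∀ n p E → E + 2 * cubeEdges p ≤ n * p →
                         2 * E + 2 * cubeEdges (2 * p) ≤ suc n * (2 * p)
cubeEdges-double-bound n p E le =
  subst (λ z → 2 * E + 2 * z ≤ suc n * (2 * p)) (sym (cubeEdges-double p))
    (double-step n p E (cubeEdges p) le)

cubeEdges-double+1-bound : ∀ n p E E′ → E + 2 * cubeEdges p ≤ n * p → E′ + 2 * cubeEdges (1 + p) ≤ n * (1 + p) →
                           E + E′ + 1 + 2 * cubeEdges (1 + 2 * p) ≤ suc n * (1 + 2 * p)
cubeEdges-double+1-bound n p E E′ le le′ =
  subst (λ z → E + E′ + 1 + 2 * z ≤ suc n * (1 + 2 * p)) (sym (cubeEdges-double+1 p))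
    (double+1-step n p E E′ (cubeEdges p) (cubeEdges (1 + p)) le le′)

private
  half-≤ : ∀ m n → 2 * m ≤ 2 * n → m ≤ n
  half-≤ _ _ = *-cancelˡ-≤ 2

  half-< : ∀ m n → 2 * m < 2 * n → m < n
  half-< = *-cancelˡ-< 2

  half-≤-odd : ∀ m n → 2 * m ≤ 1 + 2 * n → m ≤ n
  half-≤-odd m n le = m<1+n⇒m≤n (half-< m (1 + n) (subst (2 * m <_) (sym (*-suc 2 n)) (s≤s le)))

  half-+1-≤ : ∀ m n → 2 + 2 * m ≤ 2 * n → 1 + m ≤ n
  half-+1-≤ m n le = half-≤ (1 + m) n (subst (_≤ 2 * n) (sym (*-suc 2 m)) le)

cubeEdges-bound : ∀ n k → k ≤ 2 ^ n → 2 * cubeEdges k ≤ n * k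
cubeEdges-bound zero 0 _ = ≤-reflexive (cong (2 *_) cubeEdges-0)
cubeEdges-bound zero 1 _ = ≤-reflexive (cong (2 *_) cubeEdges-1)
cubeEdges-bound zero (suc (suc _)) (s≤s ())
cubeEdges-bound (suc n) k k≤ with parityView k
... | even p = cubeEdges-double-bound n p 0 (cubeEdges-bound n p (half-≤ p (2 ^ n) k≤))
... | odd p  = <⇒≤ (cubeEdges-double+1-bound n p 0 0
                      (cubeEdges-bound n p (<⇒≤ p<)) (cubeEdges-bound n (1 + p) p<))
  where
  p< : p < 2 ^ n
  p< = half-< p (2 ^ n) k≤

cubeEdges-bound-proper : ∀ n k → 0 < k → k < 2 ^ n → n + 2 * cubeEdges k ≤ n * k
cubeEdges-bound-proper zero k 0<k k<1 = contradiction (≤-trans 0<k (m<1+n⇒m≤n k<1)) λ ()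
cubeEdges-bound-proper (suc n) k 0<k k< with parityView k
... | even p with half-< 0 p 0<k | half-< p (2 ^ n) k<
...   | 0<p | p< with n
...     | zero = contradiction (≤-trans 0<p (m<1+n⇒m≤n p<)) λ ()
...     | suc n′ = ≤-trans (+-monoˡ-≤ _ (1+n≤2*n n′))
                     (cubeEdges-double-bound (suc n′) p (suc n′) (cubeEdges-bound-proper (suc n′) p 0<p p<))
  where
  1+n≤2*n : ∀ m → 1 + suc m ≤ 2 * suc m
  1+n≤2*n m = s≤s (≤-trans (≤-reflexive (cong suc (sym (+-identityʳ m)))) (m≤n+m _ m))
cubeEdges-bound-proper (suc n) k 0<k k< | odd zero =
  subst (λ z → suc n + 2 * z ≤ suc n * 1) (sym cubeEdges-1)
    (≤-reflexive (trans (+-identityʳ (suc n)) (sym (*-identityʳ (suc n)))))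
cubeEdges-bound-proper (suc n) k 0<k k< | odd p@(suc _) =
  subst (λ z → z + 2 * cubeEdges (1 + 2 * p) ≤ suc n * (1 + 2 * p)) (trans (cong (_+ 1) (+-identityʳ n)) (+-comm n 1))
    (cubeEdges-double+1-bound n p n 0 (cubeEdges-bound-proper n p (s≤s z≤n) 1+p≤) (cubeEdges-bound n (1 + p) 1+p≤))
  where
  1+p≤ : 1 + p ≤ 2 ^ n
  1+p≤ = half-+1-≤ p (2 ^ n) k<

cubeEdges-bound-middle : ∀ n r k → 2 ^ r ≤ k → k + 2 ^ r ≤ 2 ^ n → 2 ^ r * (n ∸ r) + 2 * cubeEdges k ≤ n * k
cubeEdges-bound-middle n zero k 1≤k k+1≤ =
  subst (λ z → z + 2 * cubeEdges k ≤ n * k) (sym (*-identityˡ n))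
    (cubeEdges-bound-proper n k 1≤k (subst (_≤ 2 ^ n) (+-comm k 1) k+1≤))
cubeEdges-bound-middle zero (suc r) k _ k+2^r≤1 =
  contradiction (≤-trans (*-monoʳ-≤ 2 (m^n>0 2 r)) (≤-trans (m≤n+m _ k) k+2^r≤1)) λ { (s≤s ()) }
cubeEdges-bound-middle (suc n) (suc r) k lo hi with parityView k
... | even p =
  subst (λ z → z + 2 * cubeEdges (2 * p) ≤ suc n * (2 * p)) (sym (*-assoc 2 T (n ∸ r)))
    (cubeEdges-double-bound n p (T * (n ∸ r)) (cubeEdges-bound-middle n r p (half-≤ T p lo) p+T≤))
  where
  T : ℕ
  T = 2 ^ r
  p+T≤ : p + T ≤ 2 ^ n
  p+T≤ = half-≤ (p + T) (2 ^ n) (subst (_≤ 2 * 2 ^ n) (sym (*-distribˡ-+ 2 p T)) hi)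
... | odd p = begin
  2 * T * D + 2 * cubeEdges (1 + 2 * p)
    ≡⟨ cong (_+ 2 * cubeEdges (1 + 2 * p)) (trans (*-assoc 2 T D) (cong (T * D +_) (+-identityʳ (T * D)))) ⟩
  T * D + T * D + 2 * cubeEdges (1 + 2 * p)
    ≤⟨ +-monoˡ-≤ (2 * cubeEdges (1 + 2 * p)) (m≤m+n (T * D + T * D) 1) ⟩
  T * D + T * D + 1 + 2 * cubeEdges (1 + 2 * p)
    ≤⟨ cubeEdges-double+1-bound n p (T * D) (T * D)
        (cubeEdges-bound-middle n r p T≤p (≤-trans (n≤1+n _) 1+p+T≤))
        (cubeEdges-bound-middle n r (1 + p) (≤-trans T≤p (n≤1+n p)) 1+p+T≤) ⟩
  suc n * (1 + 2 * p) ∎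
  where
  open ≤-Reasoning
  T D : ℕ
  T = 2 ^ r
  D = n ∸ r
  T≤p : T ≤ p
  T≤p = half-≤-odd T p lo
  1+p+T≤ : 1 + p + T ≤ 2 ^ n
  1+p+T≤ = half-< (p + T) (2 ^ n) (subst (_< 2 * 2 ^ n) (sym (*-distribˡ-+ 2 p T)) hi)

private
  n<2*n : ∀ {n} → 0 < n → n < 2 * n
  n<2*n {suc n} _ = s≤s (≤-trans (s≤s (m≤m+n n 0)) (m≤n+m _ n))

  n≤2*n : ∀ n → n ≤ 2 * n
  n≤2*n n = m≤m+n n (n + 0)

  Superadditive : ℕ → ℕ → Set
  Superadditive a b = cubeEdges a + cubeEdges b + a ≤ cubeEdges (a + b)

  SuperadditiveBelow : ℕ → Set
  SuperadditiveBelow s = ∀ a b → a + b < s → a ≤ b → Superadditive a b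

  superadditive-double : ∀ a → Superadditive a a
  superadditive-double a = ≤-reflexive (begin
    cubeEdges a + cubeEdges a + a  ≡⟨ cong (λ x → cubeEdges a + x + a) (sym (+-identityʳ (cubeEdges a))) ⟩
    2 * cubeEdges a + a            ≡⟨ cubeEdges-double a ⟨
    cubeEdges (2 * a)              ≡⟨ cong (λ x → cubeEdges (a + x)) (+-identityʳ a) ⟩
    cubeEdges (a + a)              ∎)
    where open ≡-Reasoning

  even-even-step : ∀ p q x y z → x + y + p ≤ z → (2 * x + p) + (2 * y + q) + 2 * p ≤ 2 * z + (p + q)
  even-even-step p q x y z le = begin
    (2 * x + p) + (2 * y + q) + 2 * p  ≡⟨ solve (p ∷ q ∷ x ∷ y ∷ []) ⟩
    2 * (x + y + p) + (p + q)          ≤⟨ +-monoˡ-≤ (p + q) (*-monoʳ-≤ 2 le) ⟩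
    2 * z + (p + q)                    ∎
    where open ≤-Reasoning

  superadditive-even-even : ∀ p q → SuperadditiveBelow (2 * p + 2 * q) → 0 < p → p ≤ q →
                            Superadditive (2 * p) (2 * q)
  superadditive-even-even p q IH 0<p p≤q = begin
    cubeEdges (2 * p) + cubeEdges (2 * q) + 2 * p
      ≡⟨ cong₂ (λ u v → u + v + 2 * p) (cubeEdges-double p) (cubeEdges-double q) ⟩
    (2 * cubeEdges p + p) + (2 * cubeEdges q + q) + 2 * p
      ≤⟨ even-even-step p q (cubeEdges p) (cubeEdges q) (cubeEdges (p + q))
          (IH p q (+-mono-<-≤ (n<2*n 0<p) (n≤2*n q)) p≤q) ⟩
    2 * cubeEdges (p + q) + (p + q)
      ≡⟨ cubeEdges-double (p + q) ⟨
    cubeEdges (2 * (p + q))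
      ≡⟨ cong cubeEdges (*-distribˡ-+ 2 p q) ⟩
    cubeEdges (2 * p + 2 * q) ∎
    where open ≤-Reasoning

  even-odd-step : ∀ p q x y y′ z z′ → x + y + p ≤ z → x + y′ + p ≤ z′ →
                  (2 * x + p) + (y + y′ + q) + 2 * p ≤ z + z′ + (p + q)
  even-odd-step p q x y y′ z z′ le le′ = begin
    (2 * x + p) + (y + y′ + q) + 2 * p     ≡⟨ solve (p ∷ q ∷ x ∷ y ∷ y′ ∷ []) ⟩
    (x + y + p) + (x + y′ + p) + (p + q)   ≤⟨ +-monoˡ-≤ (p + q) (+-mono-≤ le le′) ⟩
    z + z′ + (p + q)                       ∎
    where open ≤-Reasoning

  superadditive-even-odd : ∀ p q → SuperadditiveBelow (2 * p + (1 + 2 * q)) → 0 < p → p ≤ q →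
                           Superadditive (2 * p) (1 + 2 * q)
  superadditive-even-odd p q IH 0<p p≤q = begin
    cubeEdges (2 * p) + cubeEdges (1 + 2 * q) + 2 * p
      ≡⟨ cong₂ (λ u v → u + v + 2 * p) (cubeEdges-double p) (cubeEdges-double+1 q) ⟩
    (2 * cubeEdges p + p) + (cubeEdges q + cubeEdges (1 + q) + q) + 2 * p
      ≤⟨ even-odd-step p q (cubeEdges p) (cubeEdges q) (cubeEdges (1 + q))
          (cubeEdges (p + q)) (cubeEdges (1 + (p + q))) IH-p-q IH-p-1+q ⟩
    cubeEdges (p + q) + cubeEdges (1 + (p + q)) + (p + q)
      ≡⟨ cubeEdges-double+1 (p + q) ⟨
    cubeEdges (1 + 2 * (p + q))
      ≡⟨ cong cubeEdges (solve (p ∷ q ∷ [])) ⟩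
    cubeEdges (2 * p + (1 + 2 * q)) ∎
    where
    open ≤-Reasoning
    IH-p-q : Superadditive p q
    IH-p-q = IH p q (+-mono-<-≤ (n<2*n 0<p) (m≤n⇒m≤1+n (n≤2*n q))) p≤q
    IH-p-1+q : cubeEdges p + cubeEdges (1 + q) + p ≤ cubeEdges (1 + (p + q))
    IH-p-1+q = subst (λ z → cubeEdges p + cubeEdges (1 + q) + p ≤ cubeEdges z) (+-suc p q)
                 (IH p (1 + q) (+-mono-<-≤ (n<2*n 0<p) (s≤s (n≤2*n q))) (m≤n⇒m≤1+n p≤q))

  odd-even-step : ∀ p q x x′ y z z′ → x + y + p ≤ z → x′ + y + (1 + p) ≤ z′ →
                  (x + x′ + p) + (2 * y + q) + (1 + 2 * p) ≤ z + z′ + (p + q)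
  odd-even-step p q x x′ y z z′ le le′ = begin
    (x + x′ + p) + (2 * y + q) + (1 + 2 * p)     ≡⟨ solve (p ∷ q ∷ x ∷ x′ ∷ y ∷ []) ⟩
    (x + y + p) + (x′ + y + (1 + p)) + (p + q)   ≤⟨ +-monoˡ-≤ (p + q) (+-mono-≤ le le′) ⟩
    z + z′ + (p + q)                             ∎
    where open ≤-Reasoning

  superadditive-odd-even : ∀ p q → SuperadditiveBelow (1 + 2 * p + 2 * q) → 1 + p ≤ q →
                           Superadditive (1 + 2 * p) (2 * q)
  superadditive-odd-even p q IH 1+p≤q = begin
    cubeEdges (1 + 2 * p) + cubeEdges (2 * q) + (1 + 2 * p)
      ≡⟨ cong₂ (λ u v → u + v + (1 + 2 * p)) (cubeEdges-double+1 p) (cubeEdges-double q) ⟩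
    (cubeEdges p + cubeEdges (1 + p) + p) + (2 * cubeEdges q + q) + (1 + 2 * p)
      ≤⟨ odd-even-step p q (cubeEdges p) (cubeEdges (1 + p)) (cubeEdges q)
          (cubeEdges (p + q)) (cubeEdges (1 + (p + q))) IH-p-q IH-1+p-q ⟩
    cubeEdges (p + q) + cubeEdges (1 + (p + q)) + (p + q)
      ≡⟨ cubeEdges-double+1 (p + q) ⟨
    cubeEdges (1 + 2 * (p + q))
      ≡⟨ cong (λ z → cubeEdges (1 + z)) (*-distribˡ-+ 2 p q) ⟩
    cubeEdges (1 + 2 * p + 2 * q) ∎
    where
    open ≤-Reasoning
    0<q : 0 < q
    0<q = ≤-trans z<s 1+p≤q
    IH-p-q : Superadditive p q
    IH-p-q = IH p q (+-mono-≤-< (m≤n⇒m≤1+n (n≤2*n p)) (n<2*n 0<q)) (≤-trans (n≤1+n p) 1+p≤q)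
    IH-1+p-q : Superadditive (1 + p) q
    IH-1+p-q = IH (1 + p) q (+-mono-≤-< (s≤s (n≤2*n p)) (n<2*n 0<q)) 1+p≤q

  odd-odd-step : ∀ p q x x′ y y′ w → x + y′ + p ≤ w → x′ + y + (1 + p) ≤ w →
                 (x + x′ + p) + (y + y′ + q) + (1 + 2 * p) ≤ 2 * w + (1 + (p + q))
  odd-odd-step p q x x′ y y′ w le le′ = begin
    (x + x′ + p) + (y + y′ + q) + (1 + 2 * p)     ≡⟨ solve (p ∷ q ∷ x ∷ x′ ∷ y ∷ y′ ∷ []) ⟩
    (x + y′ + p) + (x′ + y + (1 + p)) + (p + q)   ≤⟨ +-mono-≤ (+-mono-≤ le le′) (n≤1+n (p + q)) ⟩
    w + w + (1 + (p + q))                         ≡⟨ cong (λ v → w + v + (1 + (p + q))) (sym (+-identityʳ w)) ⟩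
    2 * w + (1 + (p + q))                         ∎
    where open ≤-Reasoning

  superadditive-odd-odd : ∀ p q → SuperadditiveBelow (1 + 2 * p + (1 + 2 * q)) → 1 + p ≤ q →
                          Superadditive (1 + 2 * p) (1 + 2 * q)
  superadditive-odd-odd p q IH 1+p≤q = begin
    cubeEdges (1 + 2 * p) + cubeEdges (1 + 2 * q) + (1 + 2 * p)
      ≡⟨ cong₂ (λ u v → u + v + (1 + 2 * p)) (cubeEdges-double+1 p) (cubeEdges-double+1 q) ⟩
    (cubeEdges p + cubeEdges (1 + p) + p) + (cubeEdges q + cubeEdges (1 + q) + q) + (1 + 2 * p)
      ≤⟨ odd-odd-step p q (cubeEdges p) (cubeEdges (1 + p)) (cubeEdges q) (cubeEdges (1 + q)) (cubeEdges (1 + (p + q)))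
          IH-p-1+q IH-1+p-q ⟩
    2 * cubeEdges (1 + (p + q)) + (1 + (p + q))
      ≡⟨ cubeEdges-double (1 + (p + q)) ⟨
    cubeEdges (2 * (1 + (p + q)))
      ≡⟨ cong cubeEdges (solve (p ∷ q ∷ [])) ⟩
    cubeEdges (1 + 2 * p + (1 + 2 * q)) ∎
    where
    open ≤-Reasoning
    IH-p-1+q : cubeEdges p + cubeEdges (1 + q) + p ≤ cubeEdges (1 + (p + q))
    IH-p-1+q = subst (λ z → cubeEdges p + cubeEdges (1 + q) + p ≤ cubeEdges z) (+-suc p q)
                 (IH p (1 + q) (+-mono-<-≤ (s≤s (n≤2*n p)) (s≤s (n≤2*n q))) (≤-trans (n≤1+n p) (m≤n⇒m≤1+n 1+p≤q)))
    IH-1+p-q : Superadditive (1 + p) q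
    IH-1+p-q = IH (1 + p) q (+-mono-≤-< (s≤s (n≤2*n p)) (s≤s (n≤2*n q))) 1+p≤q

  superadditive-cases : ∀ a b → SuperadditiveBelow (a + b) → a ≤ b → Superadditive a b
  superadditive-cases a b IH a≤b with m≤n⇒m<n∨m≡n a≤b
  ... | inj₂ refl = superadditive-double a
  ... | inj₁ a<b with parityView a | parityView b
  ...   | even zero      | _      = ≤-reflexive (trans (+-identityʳ _) (cong (_+ cubeEdges b) cubeEdges-0))
  ...   | even p@(suc _) | even q = superadditive-even-even p q IH z<s (<⇒≤ (half-< p q a<b))
  ...   | even p@(suc _) | odd q  = superadditive-even-odd p q IH z<s (half-≤ p q (≤-pred a<b))
  ...   | odd p          | even q = superadditive-odd-even p q IH (half-+1-≤ p q a<b)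
  ...   | odd p          | odd q  = superadditive-odd-odd p q IH (half-< p q (≤-pred a<b))

  superadditive-step : ∀ s → WfRec _<_ (λ s → ∀ a b → a + b ≡ s → a ≤ b → Superadditive a b) s →
                       ∀ a b → a + b ≡ s → a ≤ b → Superadditive a b
  superadditive-step _ rec a b refl = superadditive-cases a b (λ a′ b′ a′+b′< → rec a′+b′< a′ b′ refl)

  superadditive : ∀ a b → a ≤ b → Superadditive a b
  superadditive a b = <-rec _ superadditive-step (a + b) a b refl

cubeEdges-superadditive : ∀ a b → cubeEdges a + cubeEdges b + a ⊓ b ≤ cubeEdges (a + b)
cubeEdges-superadditive a b with ≤-total a b
... | inj₁ a≤b = subst (λ z → cubeEdges a + cubeEdges b + z ≤ cubeEdges (a + b)) (sym (m≤n⇒m⊓n≡m a≤b)) (superadditive a b a≤b)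
... | inj₂ b≤a = subst₂ (λ z w → z ≤ cubeEdges w) (cong₂ _+_ (+-comm (cubeEdges b) (cubeEdges a)) (sym (m≥n⇒m⊓n≡n b≤a))) (+-comm b a)
                   (superadditive b a b≤a)

-- Finite sums and cardinalities

𝟙 : Bool → ℕ
𝟙 b = if b then 1 else 0

sum-mono-≤ : ∀ {n} {f g : Fin n → ℕ} → (∀ i → f i ≤ g i) → sum f ≤ sum g
sum-mono-≤ {zero} _ = z≤n
sum-mono-≤ {suc n} f≤g = +-mono-≤ (f≤g zero) (sum-mono-≤ (λ i → f≤g (suc i)))

sum-↑ : ∀ m n (f : Fin (m + n) → ℕ) → sum f ≡ sum (λ i → f (i ↑ˡ n)) + sum (λ j → f (m ↑ʳ j))
sum-↑ zero n f = refl
sum-↑ (suc m) n f = trans (cong (f zero +_) (sum-↑ m n (λ i → f (suc i)))) (sym (+-assoc (f zero) _ _))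

sum-δ : ∀ {n} (x : Fin n) (g : Fin n → ℕ) → ∑[ j < n ] (if ⌊ x ≟ j ⌋ then g j else 0) ≡ g x
sum-δ {suc n} zero g = trans (cong (g zero +_) (sum-replicate-zero n)) (+-identityʳ (g zero))
sum-δ {suc n} (suc x) g = trans (sum-cong-≗ suc-δ) (sum-δ x (λ j → g (suc j)))
  where
  suc-δ : ∀ j → (if ⌊ suc x ≟ suc j ⌋ then g (suc j) else 0) ≡ (if ⌊ x ≟ j ⌋ then g (suc j) else 0)
  suc-δ j with x ≟ j
  ... | yes _ = refl
  ... | no _ = refl

sum²-↑ : ∀ m n (f : Fin (m + n) → Fin (m + n) → ℕ) →
         ∑[ u < m + n ] ∑[ v < m + n ] f u v ≡
         (∑[ i < m ] ∑[ j < m ] f (i ↑ˡ n) (j ↑ˡ n) + ∑[ i < m ] ∑[ j < n ] f (i ↑ˡ n) (m ↑ʳ j)) +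
         (∑[ i < n ] ∑[ j < m ] f (m ↑ʳ i) (j ↑ˡ n) + ∑[ i < n ] ∑[ j < n ] f (m ↑ʳ i) (m ↑ʳ j))
sum²-↑ m n f = begin
  ∑[ u < m + n ] ∑[ v < m + n ] f u v
    ≡⟨ sum-↑ m n (λ u → ∑[ v < m + n ] f u v) ⟩
  ∑[ i < m ] ∑[ v < m + n ] f (i ↑ˡ n) v + ∑[ i < n ] ∑[ v < m + n ] f (m ↑ʳ i) v
    ≡⟨ cong₂ _+_ (split (λ i → f (i ↑ˡ n))) (split (λ i → f (m ↑ʳ i))) ⟩
  _ ∎
  where
  open ≡-Reasoning
  split : ∀ {l} (g : Fin l → Fin (m + n) → ℕ) →
          ∑[ i < l ] ∑[ v < m + n ] g i v ≡ ∑[ i < l ] ∑[ j < m ] g i (j ↑ˡ n) + ∑[ i < l ] ∑[ j < n ] g i (m ↑ʳ j)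
  split g = trans (sum-cong-≗ (λ i → sum-↑ m n (g i))) (∑-distrib-+ (λ i → ∑[ j < m ] g i (j ↑ˡ n)) (λ i → ∑[ j < n ] g i (m ↑ʳ j)))

∑∑-symmetrise : ∀ {k} (f : Fin k → Fin k → ℕ) →
                ∑[ u < k ] ∑[ v < k ] (f u v + f v u) ≡ 2 * ∑[ u < k ] ∑[ v < k ] f u v
∑∑-symmetrise {k} f = begin
  ∑[ u < k ] ∑[ v < k ] (f u v + f v u)
    ≡⟨ sum-cong-≗ (λ u → ∑-distrib-+ (f u) (λ v → f v u)) ⟩
  ∑[ u < k ] (∑[ v < k ] f u v + ∑[ v < k ] f v u)
    ≡⟨ ∑-distrib-+ (λ u → ∑[ v < k ] f u v) (λ u → ∑[ v < k ] f v u) ⟩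
  ∑[ u < k ] ∑[ v < k ] f u v + ∑[ u < k ] ∑[ v < k ] f v u
    ≡⟨ cong (∑[ u < k ] ∑[ v < k ] f u v +_) (∑-comm (λ u v → f v u)) ⟩
  ∑[ u < k ] ∑[ v < k ] f u v + ∑[ v < k ] ∑[ u < k ] f v u
    ≡⟨ cong (∑[ u < k ] ∑[ v < k ] f u v +_) (sym (+-identityʳ _)) ⟩
  2 * ∑[ u < k ] ∑[ v < k ] f u v ∎
  where open ≡-Reasoning

sum-tabulate : ∀ {k} (f : Fin k → ℕ) → List.sum (tabulate f) ≡ sum f
sum-tabulate {zero} f = refl
sum-tabulate {suc k} f = cong (f zero +_) (sum-tabulate (λ i → f (suc i)))

sum-allFin : ∀ {k} (f : Fin k → ℕ) → List.sum (map f (allFin k)) ≡ sum f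
sum-allFin {k} f = trans (cong List.sum (List.map-tabulate (λ i → i) f)) (sum-tabulate f)

∣_∣ : ∀ {k} → (Fin k → Bool) → ℕ
∣ X ∣ = sum (λ i → 𝟙 (X i))

∣∣-≤ : ∀ {k} (X : Fin k → Bool) → ∣ X ∣ ≤ k
∣∣-≤ {zero} X = z≤n
∣∣-≤ {suc k} X with X zero
... | true  = s≤s (∣∣-≤ (λ i → X (suc i)))
... | false = m≤n⇒m≤1+n (∣∣-≤ (λ i → X (suc i)))

∣∣-full : ∀ {k} (X : Fin k → Bool) → (∀ i → X i ≡ true) → ∣ X ∣ ≡ k
∣∣-full {zero} X _ = refl
∣∣-full {suc k} X full rewrite full zero = cong suc (∣∣-full (λ i → X (suc i)) (λ i → full (suc i)))

∣∣-∪ : ∀ {k} (X Y : Fin k → Bool) → ∣ (λ x → X x ∨ Y x) ∣ ≤ ∣ X ∣ + ∣ Y ∣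
∣∣-∪ X Y = ≤-trans (sum-mono-≤ (λ x → 𝟙-∨ (X x) (Y x))) (≤-reflexive (∑-distrib-+ (λ x → 𝟙 (X x)) (λ x → 𝟙 (Y x))))
  where
  𝟙-∨ : ∀ p q → 𝟙 (p ∨ q) ≤ 𝟙 p + 𝟙 q
  𝟙-∨ true _ = s≤s z≤n
  𝟙-∨ false _ = ≤-refl

∣∣-insert : ∀ {k} (X : Fin k → Bool) w → X w ≡ false → ∣ (λ x → X x ∨ ⌊ w ≟ x ⌋) ∣ ≡ suc ∣ X ∣
∣∣-insert {k} X w Xw = begin
  ∣ (λ x → X x ∨ ⌊ w ≟ x ⌋) ∣                               ≡⟨ sum-cong-≗ 𝟙-insert ⟩
  ∑[ x < k ] (𝟙 (X x) + (if ⌊ w ≟ x ⌋ then 1 else 0))       ≡⟨ ∑-distrib-+ (λ x → 𝟙 (X x)) _ ⟩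
  ∣ X ∣ + ∑[ x < k ] (if ⌊ w ≟ x ⌋ then 1 else 0)           ≡⟨ cong (∣ X ∣ +_) (sum-δ w (λ _ → 1)) ⟩
  ∣ X ∣ + 1                                                 ≡⟨ +-comm ∣ X ∣ 1 ⟩
  suc ∣ X ∣                                                 ∎
  where
  open ≡-Reasoning
  𝟙-insert : ∀ x → 𝟙 (X x ∨ ⌊ w ≟ x ⌋) ≡ 𝟙 (X x) + (if ⌊ w ≟ x ⌋ then 1 else 0)
  𝟙-insert x with w ≟ x
  ... | yes refl rewrite Xw = refl
  ... | no _ = trans (cong 𝟙 (Bool.∨-identityʳ (X x))) (sym (+-identityʳ (𝟙 (X x))))

elements : ∀ {k} → (Fin k → Bool) → List (Fin k)
elements {k} X = filter (λ u → X u Bool.≟ true) (allFin k)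

elements-unique : ∀ {k} (X : Fin k → Bool) → Unique (elements X)
elements-unique {k} X = filter⁺ (λ u → X u Bool.≟ true) (allFin⁺ k)

elements-member : ∀ {k} (X : Fin k → Bool) → All (λ u → X u ≡ true) (elements X)
elements-member {k} X = all-filter (λ u → X u Bool.≟ true) (allFin k)

length-elements : ∀ {k} (X : Fin k → Bool) → length (elements X) ≡ ∣ X ∣
length-elements {k} X = length-filter-tabulate (λ i → i)
  where
  length-filter-tabulate : ∀ {l} (g : Fin l → Fin k) →
                           length (filter (λ u → X u Bool.≟ true) (tabulate g)) ≡ ∣ (λ i → X (g i)) ∣
  length-filter-tabulate {zero} g = refl
  length-filter-tabulate {suc l} g with X (g zero)
  ... | true  = cong suc (length-filter-tabulate (λ i → g (suc i)))
  ... | false = length-filter-tabulate (λ i → g (suc i))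

-- Edge boundaries in HL-networks

boundary : ∀ {k} → Graph k → (Fin k → Bool) → ℕ
boundary {k} G X = ∑[ u < k ] ∑[ v < k ] 𝟙 (X u ∧ not (X v) ∧ G u v)

module JoinSplit {m : ℕ} (G₀ G₁ : Graph m) (M : PerfectMatching m) (X : Fin (m + m) → Bool) where
  open PerfectMatching M

  private
    join-↑ˡ-↑ˡ : ∀ i j → (join G₀ G₁ M) (i ↑ˡ m) (j ↑ˡ m) ≡ G₀ i j
    join-↑ˡ-↑ˡ i j rewrite splitAt-↑ˡ m i m | splitAt-↑ˡ m j m = refl

    join-↑ˡ-↑ʳ : ∀ i j → (join G₀ G₁ M) (i ↑ˡ m) (m ↑ʳ j) ≡ ⌊ σ i ≟ j ⌋
    join-↑ˡ-↑ʳ i j rewrite splitAt-↑ˡ m i m | splitAt-↑ʳ m m j = refl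

    join-↑ʳ-↑ˡ : ∀ i j → (join G₀ G₁ M) (m ↑ʳ i) (j ↑ˡ m) ≡ ⌊ σ j ≟ i ⌋
    join-↑ʳ-↑ˡ i j rewrite splitAt-↑ʳ m m i | splitAt-↑ˡ m j m = refl

    join-↑ʳ-↑ʳ : ∀ i j → (join G₀ G₁ M) (m ↑ʳ i) (m ↑ʳ j) ≡ G₁ i j
    join-↑ʳ-↑ʳ i j rewrite splitAt-↑ʳ m m i | splitAt-↑ʳ m m j = refl

    𝟙-∧-if : ∀ b d → 𝟙 (b ∧ d) ≡ (if d then 𝟙 b else 0)
    𝟙-∧-if true _ = refl
    𝟙-∧-if false false = refl
    𝟙-∧-if false true = refl

    𝟙-∧∧-if : ∀ p q d → 𝟙 (p ∧ q ∧ d) ≡ (if d then 𝟙 (p ∧ q) else 0)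
    𝟙-∧∧-if p q d = trans (cong 𝟙 (sym (Bool.∧-assoc p q d))) (𝟙-∧-if (p ∧ q) d)

  X₀ X₁ : Fin m → Bool
  X₀ i = X (i ↑ˡ m)
  X₁ j = X (m ↑ʳ j)

  leaving₀ leaving₁ : ℕ
  leaving₀ = ∑[ i < m ] 𝟙 (X₀ i ∧ not (X₁ (σ i)))
  leaving₁ = ∑[ i < m ] 𝟙 (X₁ (σ i) ∧ not (X₀ i))

  ∣join∣ : ∣ X ∣ ≡ ∣ X₀ ∣ + ∣ X₁ ∣
  ∣join∣ = sum-↑ m m (λ u → 𝟙 (X u))

  boundary-join : boundary (join G₀ G₁ M) X ≡ (boundary G₀ X₀ + leaving₀) + (leaving₁ + boundary G₁ X₁)
  boundary-join = trans (sum²-↑ m m F) (cong₂ _+_ (cong₂ _+_ block₀₀ block₀₁) (cong₂ _+_ block₁₀ block₁₁))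
    where
    F : Fin (m + m) → Fin (m + m) → ℕ
    F u v = 𝟙 (X u ∧ not (X v) ∧ join G₀ G₁ M u v)
    block₀₀ : ∑[ i < m ] ∑[ j < m ] F (i ↑ˡ m) (j ↑ˡ m) ≡ boundary G₀ X₀
    block₀₀ = sum-cong-≗ λ i → sum-cong-≗ λ j → cong (λ e → 𝟙 (X₀ i ∧ not (X₀ j) ∧ e)) (join-↑ˡ-↑ˡ i j)
    block₁₁ : ∑[ i < m ] ∑[ j < m ] F (m ↑ʳ i) (m ↑ʳ j) ≡ boundary G₁ X₁
    block₁₁ = sum-cong-≗ λ i → sum-cong-≗ λ j → cong (λ e → 𝟙 (X₁ i ∧ not (X₁ j) ∧ e)) (join-↑ʳ-↑ʳ i j)
    block₀₁ : ∑[ i < m ] ∑[ j < m ] F (i ↑ˡ m) (m ↑ʳ j) ≡ leaving₀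
    block₀₁ = sum-cong-≗ λ i → trans
      (sum-cong-≗ λ j → trans (cong (λ e → 𝟙 (X₀ i ∧ not (X₁ j) ∧ e)) (join-↑ˡ-↑ʳ i j)) (𝟙-∧∧-if (X₀ i) (not (X₁ j)) _))
      (sum-δ (σ i) (λ j → 𝟙 (X₀ i ∧ not (X₁ j))))
    block₁₀ : ∑[ i < m ] ∑[ j < m ] F (m ↑ʳ i) (j ↑ˡ m) ≡ leaving₁
    block₁₀ = trans (∑-comm (λ i j → F (m ↑ʳ i) (j ↑ˡ m))) (sum-cong-≗ λ j → trans
      (sum-cong-≗ λ i → trans (cong (λ e → 𝟙 (X₁ i ∧ not (X₀ j) ∧ e)) (join-↑ʳ-↑ˡ i j)) (𝟙-∧∧-if (X₁ i) (not (X₀ j)) _))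
      (sum-δ (σ j) (λ i → 𝟙 (X₁ i ∧ not (X₀ j)))))

  private
    π : Permutation′ m
    π = permutation σ σ⁻¹ right left

    𝟙-≤-∧-not : ∀ p q → 𝟙 p ≤ 𝟙 (p ∧ not q) + 𝟙 q
    𝟙-≤-∧-not true true = s≤s z≤n
    𝟙-≤-∧-not true false = s≤s z≤n
    𝟙-≤-∧-not false _ = z≤n

  ∣X₀∣-≤ : ∣ X₀ ∣ ≤ leaving₀ + ∣ X₁ ∣
  ∣X₀∣-≤ = begin
    ∣ X₀ ∣
      ≤⟨ sum-mono-≤ (λ i → 𝟙-≤-∧-not (X₀ i) (X₁ (σ i))) ⟩
    ∑[ i < m ] (𝟙 (X₀ i ∧ not (X₁ (σ i))) + 𝟙 (X₁ (σ i)))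
      ≡⟨ ∑-distrib-+ (λ i → 𝟙 (X₀ i ∧ not (X₁ (σ i)))) (λ i → 𝟙 (X₁ (σ i))) ⟩
    leaving₀ + ∑[ i < m ] 𝟙 (X₁ (σ i))
      ≡⟨ cong (leaving₀ +_) (∑-permute (λ i → 𝟙 (X₁ i)) π) ⟨
    leaving₀ + ∣ X₁ ∣ ∎
    where open ≤-Reasoning

  ∣X₁∣-≤ : ∣ X₁ ∣ ≤ leaving₁ + ∣ X₀ ∣
  ∣X₁∣-≤ = begin
    ∣ X₁ ∣
      ≡⟨ ∑-permute (λ i → 𝟙 (X₁ i)) π ⟩
    ∑[ i < m ] 𝟙 (X₁ (σ i))
      ≤⟨ sum-mono-≤ (λ i → 𝟙-≤-∧-not (X₁ (σ i)) (X₀ i)) ⟩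
    ∑[ i < m ] (𝟙 (X₁ (σ i) ∧ not (X₀ i)) + 𝟙 (X₀ i))
      ≡⟨ ∑-distrib-+ (λ i → 𝟙 (X₁ (σ i) ∧ not (X₀ i))) (λ i → 𝟙 (X₀ i)) ⟩
    leaving₁ + ∣ X₀ ∣ ∎
    where open ≤-Reasoning

private
  matching-bound : ∀ {a b x y} → a ≤ x + b → b ≤ y + a → a + b ≤ x + y + 2 * (a ⊓ b)
  matching-bound {a} {b} {x} {y} a≤ b≤ with ≤-total a b
  ... | inj₁ a≤b = begin
    a + b              ≤⟨ +-monoʳ-≤ a b≤ ⟩
    a + (y + a)        ≡⟨ solve (a ∷ y ∷ []) ⟩
    y + 2 * a          ≤⟨ m≤n+m (y + 2 * a) x ⟩
    x + (y + 2 * a)    ≡⟨ cong (λ c → x + (y + 2 * c)) (m≤n⇒m⊓n≡m a≤b) ⟨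
    x + (y + 2 * (a ⊓ b))  ≡⟨ +-assoc x y _ ⟨
    x + y + 2 * (a ⊓ b)    ∎
    where open ≤-Reasoning
  ... | inj₂ b≤a = begin
    a + b              ≤⟨ +-monoˡ-≤ b a≤ ⟩
    x + b + b          ≡⟨ solve (x ∷ b ∷ []) ⟩
    x + 2 * b          ≤⟨ +-monoˡ-≤ (2 * b) (m≤m+n x y) ⟩
    x + y + 2 * b      ≡⟨ cong (λ c → x + y + 2 * c) (m≥n⇒m⊓n≡n b≤a) ⟨
    x + y + 2 * (a ⊓ b)    ∎
    where open ≤-Reasoning

  join-step : ∀ n a b c B₀ B₁ x y h₀ h₁ h →
              n * a ≤ B₀ + 2 * h₀ → n * b ≤ B₁ + 2 * h₁ → a + b ≤ x + y + 2 * c → h₀ + h₁ + c ≤ h →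
              suc n * (a + b) ≤ (B₀ + x) + (y + B₁) + 2 * h
  join-step n a b c B₀ B₁ x y h₀ h₁ h ia ib ab hc = begin
    suc n * (a + b)                                        ≡⟨ solve (n ∷ a ∷ b ∷ []) ⟩
    n * a + n * b + (a + b)                                ≤⟨ +-mono-≤ (+-mono-≤ ia ib) ab ⟩
    (B₀ + 2 * h₀) + (B₁ + 2 * h₁) + (x + y + 2 * c)        ≡⟨ solve (c ∷ B₀ ∷ B₁ ∷ x ∷ y ∷ h₀ ∷ h₁ ∷ []) ⟩
    (B₀ + x) + (y + B₁) + 2 * (h₀ + h₁ + c)                ≤⟨ +-monoʳ-≤ ((B₀ + x) + (y + B₁)) (*-monoʳ-≤ 2 hc) ⟩
    (B₀ + x) + (y + B₁) + 2 * h                            ∎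
    where open ≤-Reasoning

HL-isoperimetric : ∀ {n k G} → HL n k G → ∀ X → n * ∣ X ∣ ≤ boundary G X + 2 * cubeEdges ∣ X ∣
HL-isoperimetric hl₀ X = z≤n
HL-isoperimetric (hl₊ {n} {m} {G₀} {G₁} hl-G₀ hl-G₁ M) X =
  subst₂ (λ c B → suc n * c ≤ B + 2 * cubeEdges c) (sym ∣join∣) (sym boundary-join)
    (join-step n a b (a ⊓ b) (boundary G₀ X₀) (boundary G₁ X₁) leaving₀ leaving₁
               (cubeEdges a) (cubeEdges b) (cubeEdges (a + b))
      (HL-isoperimetric hl-G₀ X₀) (HL-isoperimetric hl-G₁ X₁)
      (matching-bound ∣X₀∣-≤ ∣X₁∣-≤) (cubeEdges-superadditive a b))
  where
  open JoinSplit G₀ G₁ M X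
  a b : ℕ
  a = ∣ X₀ ∣
  b = ∣ X₁ ∣

Loopless : ∀ {k} → Graph k → Set
Loopless G = ∀ x → G x x ≡ false

HL-loopless : ∀ {n k G} → HL n k G → Loopless G
HL-loopless hl₀ x = refl
HL-loopless (hl₊ {m = m} hl-G₀ hl-G₁ _) x with splitAt m x
... | inj₁ u = HL-loopless hl-G₀ u
... | inj₂ u = HL-loopless hl-G₁ u

-- Sets closed in G − S

Closed : ∀ {k} → Graph k → (Fin k → Bool) → Set
Closed H X = ∀ u w → X u ≡ true → H u w ≡ true → X w ≡ true

𝟙-<ᵇ-trichotomy : ∀ {m n} → m ≢ n → 𝟙 (m <ᵇ n) + 𝟙 (n <ᵇ m) ≡ 1
𝟙-<ᵇ-trichotomy {zero} {zero} m≢n = contradiction refl m≢n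
𝟙-<ᵇ-trichotomy {zero} {suc n} _ = refl
𝟙-<ᵇ-trichotomy {suc m} {zero} _ = refl
𝟙-<ᵇ-trichotomy {suc m} {suc n} m≢n = 𝟙-<ᵇ-trichotomy (λ m≡n → m≢n (cong suc m≡n))

module _ {k : ℕ} {G : Graph k} (S : EdgeSubset G) (loopless : Loopless G) where
  open EdgeSubset S using (mem; sub)

  private
    S< : Fin k → Fin k → ℕ
    S< u v = 𝟙 ((toℕ u <ᵇ toℕ v) ∧ mem u v)

    S-leaving : (Fin k → Bool) → Fin k → Fin k → ℕ
    S-leaving X u v = 𝟙 (X u ∧ not (X v) ∧ mem u v)

    size-as-sum : size S ≡ ∑[ u < k ] ∑[ v < k ] S< u v
    size-as-sum = trans (sum-allFin (λ u → List.sum (map (S< u) (allFin k)))) (sum-cong-≗ λ u → sum-allFin (S< u))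

    leaving-in-S : ∀ {X} → Closed (G ─ S) X → ∀ u v → 𝟙 (X u ∧ not (X v) ∧ G u v) ≤ S-leaving X u v
    leaving-in-S {X} closed u v with X u in Xu | X v in Xv | G u v in Guv | mem u v in Suv
    ... | false | _     | _     | _     = z≤n
    ... | true  | true  | _     | _     = z≤n
    ... | true  | false | false | _     = z≤n
    ... | true  | false | true  | true  = ≤-refl
    ... | true  | false | true  | false =
      contradiction (trans (sym Xv) (closed u v Xu (cong₂ (λ g s → g ∧ not s) Guv Suv))) λ ()

    leaving-pair : ∀ a b s → 𝟙 (a ∧ not b ∧ s) + 𝟙 (b ∧ not a ∧ s) ≤ 𝟙 s
    leaving-pair true  true  _ = z≤n
    leaving-pair false false _ = z≤n
    leaving-pair true  false s = ≤-reflexive (+-identityʳ (𝟙 s))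
    leaving-pair false true  s = ≤-refl

    𝟙-mem : ∀ u v → 𝟙 (mem u v) ≡ S< u v + S< v u
    𝟙-mem u v rewrite sym (EdgeSubset.sym S u v) with mem u v in Suv
    ... | false = cong₂ _+_ (cong 𝟙 (sym (Bool.∧-zeroʳ (toℕ u <ᵇ toℕ v)))) (cong 𝟙 (sym (Bool.∧-zeroʳ (toℕ v <ᵇ toℕ u))))
    ... | true  = trans (sym (𝟙-<ᵇ-trichotomy (λ eq → u≢v (toℕ-injective eq))))
                        (cong₂ _+_ (cong 𝟙 (sym (Bool.∧-identityʳ (toℕ u <ᵇ toℕ v))))
                                   (cong 𝟙 (sym (Bool.∧-identityʳ (toℕ v <ᵇ toℕ u)))))
      where
      u≢v : u ≢ v
      u≢v refl = contradiction (trans (sym (sub u u Suv)) (loopless u)) λ ()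

  closed-boundary-≤-size : ∀ {X} → Closed (G ─ S) X → boundary G X ≤ size S
  closed-boundary-≤-size {X} closed = *-cancelˡ-≤ 2 (begin
    2 * boundary G X
      ≤⟨ *-monoʳ-≤ 2 (sum-mono-≤ λ u → sum-mono-≤ λ v → leaving-in-S closed u v) ⟩
    2 * ∑[ u < k ] ∑[ v < k ] S-leaving X u v
      ≡⟨ ∑∑-symmetrise (S-leaving X) ⟨
    ∑[ u < k ] ∑[ v < k ] (S-leaving X u v + S-leaving X v u) ≤⟨ sum-mono-≤ (λ u → sum-mono-≤ λ v → pair u v) ⟩
    ∑[ u < k ] ∑[ v < k ] 𝟙 (mem u v)
      ≡⟨ sum-cong-≗ (λ u → sum-cong-≗ λ v → 𝟙-mem u v) ⟩
    ∑[ u < k ] ∑[ v < k ] (S< u v + S< v u)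
      ≡⟨ ∑∑-symmetrise S< ⟩
    2 * ∑[ u < k ] ∑[ v < k ] S< u v
      ≡⟨ cong (2 *_) size-as-sum ⟨
    2 * size S ∎)
    where
    open ≤-Reasoning
    pair : ∀ u v → S-leaving X u v + S-leaving X v u ≤ 𝟙 (mem u v)
    pair u v rewrite EdgeSubset.sym S v u = leaving-pair (X u) (X v) (mem u v)

middle-closed⇒size-≥ : ∀ {n k G} → HL n k G → (S : EdgeSubset G) → ∀ r {X} → Closed (G ─ S) X →
               2 ^ r ≤ ∣ X ∣ → ∣ X ∣ + 2 ^ r ≤ 2 ^ n → 2 ^ r * (n ∸ r) ≤ size S
middle-closed⇒size-≥ {n} hl S r {X} closed lo hi =
  ≤-trans (+-cancelʳ-≤ (2 * cubeEdges ∣ X ∣) _ _ (≤-trans (cubeEdges-bound-middle n r ∣ X ∣ lo hi) (HL-isoperimetric hl X)))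
          (closed-boundary-≤-size S (HL-loopless hl) closed)

-- Components

Reach-snoc : ∀ {k} {H : Graph k} {c u w} → Reach H c u → H u w ≡ true → Reach H c w
Reach-snoc here Huw = step Huw here
Reach-snoc (step Hcv v↝u) Huw = step Hcv (Reach-snoc v↝u Huw)

module Components {k : ℕ} (H : Graph k) where

  record Component (c : Fin k) : Set where
    field
      member    : Fin k → Bool
      has-root  : member c ≡ true
      reachable : ∀ u → member u ≡ true → Reach H c u
      closed    : Closed H member

  private
    leaves : (Fin k → Bool) → Fin k → Fin k → Bool
    leaves R u w = R u ∧ H u w ∧ not (R w)

    leaves-true : ∀ R u w → leaves R u w ≡ true → R u ≡ true × H u w ≡ true × R w ≡ false
    leaves-true R u w eq with R u | H u w | R w
    leaves-true R u w refl | true | true | false = refl , refl , refl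

    leaves-intro : ∀ R u w → R u ≡ true → H u w ≡ true → R w ≡ false → leaves R u w ≡ true
    leaves-intro R u w Ru Huw Rw rewrite Ru | Huw | Rw = refl

    grow : ∀ {c} fuel (R : Fin k → Bool) → R c ≡ true → (∀ u → R u ≡ true → Reach H c u) →
           k ≤ ∣ R ∣ + fuel → Component c
    grow {c} fuel R Rc reach k≤ with any? (λ u → any? (λ w → leaves R u w Bool.≟ true))
    ... | no no-leaving = record { member = R ; has-root = Rc ; reachable = reach ; closed = closed }
      where
      closed : Closed H R
      closed u w Ru Huw with R w in Rw
      ... | true  = refl
      ... | false = contradiction (u , w , leaves-intro R u w Ru Huw Rw) no-leaving
    ... | yes (u , w , leaving) with leaves-true R u w leaving
    ...   | Ru , Huw , Rw = continue fuel k≤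
      where
      R′ : Fin k → Bool
      R′ x = R x ∨ ⌊ w ≟ x ⌋
      ∣R′∣ : ∣ R′ ∣ ≡ suc ∣ R ∣
      ∣R′∣ = ∣∣-insert R w Rw
      reach′ : ∀ x → R′ x ≡ true → Reach H c x
      reach′ x R′x with R x in Rx | w ≟ x
      reach′ x _  | true  | _        = reach x Rx
      reach′ x _  | false | yes refl = Reach-snoc (reach u Ru) Huw
      reach′ x () | false | no _
      continue : ∀ fuel → k ≤ ∣ R ∣ + fuel → Component c
      continue zero k≤ = ⊥-elim (<-irrefl refl (≤-trans (≤-trans (≤-reflexive (sym ∣R′∣)) (∣∣-≤ R′))
                                                          (≤-trans k≤ (≤-reflexive (+-identityʳ ∣ R ∣)))))
      continue (suc fuel) k≤ = grow fuel R′ (cong (_∨ ⌊ w ≟ c ⌋) Rc) reach′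
                                 (subst (k ≤_) (trans (+-suc ∣ R ∣ fuel) (cong (_+ fuel) (sym ∣R′∣))) k≤)

  component : ∀ c → Component c
  component c = grow k (λ x → ⌊ c ≟ x ⌋) (trans (isYes≗does (c ≟ c)) (dec-true (c ≟ c) refl)) reach-root (m≤n+m k _)
    where
    reach-root : ∀ u → ⌊ c ≟ u ⌋ ≡ true → Reach H c u
    reach-root u c≟u with c ≟ u
    reach-root u _  | yes refl = here
    reach-root u () | no _

  open Component public

  private
    ⋃ : List (Fin k) → Fin k → Bool
    ⋃ []       _ = false
    ⋃ (c ∷ cs) x = member (component c) x ∨ ⋃ cs x

    ⋃-closed : ∀ cs → Closed H (⋃ cs)
    ⋃-closed []       u w () _
    ⋃-closed (c ∷ cs) u w ⋃u Huw with member (component c) u in Cu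
    ... | true  rewrite closed (component c) u w Cu Huw = refl
    ... | false rewrite ⋃-closed cs u w ⋃u Huw = Bool.∨-zeroʳ _

    ⋃-∋ : ∀ {x} cs → x ∈ cs → ⋃ cs x ≡ true
    ⋃-∋ {x} (.x ∷ cs) (here refl) rewrite has-root (component x) = refl
    ⋃-∋ {x} (c ∷ cs) (there x∈cs) rewrite ⋃-∋ cs x∈cs = Bool.∨-zeroʳ _

    -- Drop components while the union of the rest keeps at least T vertices; the last
    -- union kept exceeds the next one by a single component, of size below T.
    ⋃-crossing : ∀ {T} → 0 < T → (∀ c → ∣ member (component c) ∣ < T) → ∀ cs → T ≤ ∣ ⋃ cs ∣ →
                 Σ (List (Fin k)) λ ds → T ≤ ∣ ⋃ ds ∣ × ∣ ⋃ ds ∣ < 2 * T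
    ⋃-crossing {T} 0<T small [] T≤0 = contradiction (≤-trans 0<T (≤-trans T≤0 (≤-reflexive (sum-replicate-zero k)))) λ ()
    ⋃-crossing {T} 0<T small (c ∷ cs) T≤ with T ≤? ∣ ⋃ cs ∣
    ... | yes T≤⋃cs = ⋃-crossing 0<T small cs T≤⋃cs
    ... | no  ⋃cs<T = c ∷ cs , T≤ , ≤-trans (s≤s (∣∣-∪ (member (component c)) (⋃ cs)))
                                      (≤-trans (+-mono-≤ (small c) (<⇒≤ (≰⇒> ⋃cs<T)))
                                               (≤-reflexive (cong (T +_) (sym (+-identityʳ T)))))

  closed-set-between : ∀ {T} → 0 < T → T ≤ k → (∀ c → ∣ member (component c) ∣ < T) →
                       Σ (Fin k → Bool) λ X → Closed H X × T ≤ ∣ X ∣ × ∣ X ∣ < 2 * T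
  closed-set-between {T} 0<T T≤k small with ⋃-crossing 0<T small (allFin k) T≤⋃all
    where
    T≤⋃all : T ≤ ∣ ⋃ (allFin k) ∣
    T≤⋃all = subst (T ≤_) (sym (∣∣-full _ (λ x → ⋃-∋ (allFin k) (∈-allFin x)))) T≤k
  ... | ds , T≤ , <2T = ⋃ ds , ⋃-closed ds , T≤ , <2T

  large-component : ∀ {T} → 0 < T → 2 * T + T ≤ k →
                    (∀ {X} → Closed H X → T ≤ ∣ X ∣ → ∣ X ∣ + T ≤ k → ⊥) →
                    Σ (Fin k) λ c → k < ∣ member (component c) ∣ + T
  large-component {T} 0<T 3T≤k no-middle with any? (λ c → T ≤? ∣ member (component c) ∣)
  ... | yes (c , T≤C) = c , ≰⇒> (no-middle (closed (component c)) T≤C)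
  ... | no all-small with closed-set-between 0<T (≤-trans (m≤n+m T (2 * T)) 3T≤k) (λ c → ≰⇒> λ T≤C → all-small (c , T≤C))
  ...   | X , closed-X , T≤X , X<2T = ⊥-elim (no-middle closed-X T≤X (≤-trans (<⇒≤ (+-monoˡ-< T X<2T)) 3T≤k))

private
  m∸1<m : ∀ {m} → 0 < m → m ∸ 1 < m
  m∸1<m {suc m} _ = ≤-refl

  m<n+o⇒m∸[o∸1]≤n : ∀ {m n o} → 0 < o → m < n + o → m ∸ (o ∸ 1) ≤ n
  m<n+o⇒m∸[o∸1]≤n {m} {n} {suc o} _ m<n+o =
    m≤n+o⇒m∸n≤o m o (≤-trans (m<1+n⇒m≤n (subst (m <_) (+-suc n o) m<n+o)) (≤-reflexive (+-comm n o)))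

lemma2p7 : (n r : ℕ) → 3 ≤ n → r ≤ n ∸ 2 →
    (G : Graph (2 ^ n)) → HL n (2 ^ n) G →
    (S : EdgeSubset G) → size S ≤ 2 ^ r * (n ∸ r) ∸ 1 →
    Σ (Fin (2 ^ n)) λ c → Σ (List (Fin (2 ^ n))) λ C →
      Unique C × All (Reach (G ─ S) c) C × 2 ^ n ∸ (2 ^ r ∸ 1) ≤ length C
lemma2p7 n r 3≤n r≤n∸2 G hl S small =
  c , elements C , elements-unique C , All.map (reachable (component c) _) (elements-member C) ,
  subst (2 ^ n ∸ (T ∸ 1) ≤_) (sym (length-elements C)) (m<n+o⇒m∸[o∸1]≤n 0<T 2^n<∣C∣+T)
  where
  open Components (G ─ S)
  T : ℕ
  T = 2 ^ r
  0<T : 0 < T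
  0<T = m^n>0 2 r
  2+r≤n : 2 + r ≤ n
  2+r≤n = subst (_≤ n) (+-comm r 2) (m≤o∸n⇒m+n≤o r (≤-trans (n≤1+n 2) 3≤n) r≤n∸2)
  3T≤2^n : 2 * T + T ≤ 2 ^ n
  3T≤2^n = ≤-trans (+-monoʳ-≤ (2 * T) (≤-trans (m≤m+n T (T + 0)) (m≤m+n (2 * T) 0))) (^-monoʳ-≤ 2 2+r≤n)
  0<T*[n∸r] : 0 < T * (n ∸ r)
  0<T*[n∸r] = *-mono-≤ 0<T (m<n⇒0<n∸m (≤-trans (n≤1+n _) 2+r≤n))
  no-middle : ∀ {X} → Closed (G ─ S) X → T ≤ ∣ X ∣ → ∣ X ∣ + T ≤ 2 ^ n → ⊥
  no-middle closed-X lo hi =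
    <-irrefl refl (<-≤-trans (m∸1<m 0<T*[n∸r]) (≤-trans (middle-closed⇒size-≥ hl S r closed-X lo hi) small))
  large : Σ (Fin (2 ^ n)) λ c → 2 ^ n < ∣ member (component c) ∣ + T
  large = large-component 0<T 3T≤2^n no-middle
  c : Fin (2 ^ n)
  c = proj₁ large
  C : Fin (2 ^ n) → Bool
  C = member (component c)
  2^n<∣C∣+T : 2 ^ n < ∣ C ∣ + T
  2^n<∣C∣+T = proj₂ large
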